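{- Let $a,b$ be positive integers, let $k$ be a positive integer dividing $b$, and let $\gamma=(\gamma_1,\gamma_2,\dots,\gamma_{b/k})$ be a strictly decreasing sequence of nonnegative integers with $\gamma_{b/k}=0$, $\gamma_1=2(b/k-1)$ and $\sum_{h=1}^{b/k}\gamma_h=(b/k)^2-b/k$. Then, for this fixed $\gamma$, $$q^{b^2/k-b} \binom{k(a+2)-b(2-1/k)}{b/k}_q$$ is the generating function (by $q^{\Theta_1+\dots+\Theta_b}$) for all sequences of integers $a\ge\Theta_1\ge\Theta_2\ge\dots\ge\Theta_b\ge0$ (i.e. partitions contained inside an $a\times b$ rectangle, padded with zeros to $b$ entries) satisfying: (1) $\Theta_{ik+1}-\Theta_{(i+1)k}\le1$ for all $i=0,1,\dots,b/k-1$; (2) $\Theta_{ck+h}-\Theta_{(c+1)k+h}\ge\gamma_{c+1}-\gamma_{c+2}$ for all $c=0,1,\dots,b/k-2$ and all $h=1,2,\dots,k$.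
   Context: $\binom{n}{m}_q$ denotes the Gaussian polynomial ($q$-binomial coefficient) $\frac{(1-q)\cdots(1-q^n)}{(1-q)\cdots(1-q^m)(1-q)\cdots(1-q^{n-m})}$. -}

module Defs where

open import Data.Nat using (ℕ; zero; suc; _+_; _*_; _∸_; _≤_; _<_; _≤?_; _<?_; z≤n; s≤s; NonZero)
open import Data.Nat.Properties using (≤-pred)
import Data.Nat.Properties as ℕP
open import Data.Integer using (ℤ; +_; -[1+_])
import Data.Integer as ℤ
open import Data.List using (List; []; _∷_; map; concatMap; length; filter; upTo; replicate; _++_)
open import Data.Vec using (Vec; []; _∷_; toList)
import Data.Vec as Vec
open import Data.Product using (_×_; _,_)
open import Data.Empty using (⊥-elim)
open import Relation.Nullary using (Dec; yes; no; ¬_)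
open import Relation.Nullary.Decidable using (_×-dec_)
open import Relation.Binary.PropositionalEquality using (_≡_; refl)
import Data.Nat as ℕ

-- Integer polynomials in q, as coefficient lists (constant term first)

Poly : Set
Poly = List ℤ

coeff : Poly → ℕ → ℤ
coeff []       _       = + 0
coeff (c ∷ p)  zero    = c
coeff (c ∷ p)  (suc n) = coeff p n

infixl 6 _+P_
infixl 7 _*P_
infix  4 _≈P_

_+P_ : Poly → Poly → Poly
[]      +P q       = q
(c ∷ p) +P []      = c ∷ p
(c ∷ p) +P (d ∷ q) = (c ℤ.+ d) ∷ (p +P q)

_*P_ : Poly → Poly → Poly
[]      *P q = []
(c ∷ p) *P q = map (c ℤ.*_) q +P (+ 0 ∷ (p *P q))

_≈P_ : Poly → Poly → Set
p ≈P q = ∀ n → coeff p n ≡ coeff q n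

zeroP : Poly
zeroP = []

oneP : Poly
oneP = + 1 ∷ []

qPow : ℕ → Poly
qPow s = replicate s (+ 0) ++ (+ 1 ∷ [])

oneMinusQPow : ℕ → Poly
oneMinusQPow i = oneP +P map ℤ.-_ (qPow i)

qPoch : ℕ → Poly
qPoch zero    = oneP
qPoch (suc m) = qPoch m *P oneMinusQPow (suc m)

-- "G = q^s * [N choose m]_q" for the Gaussian polynomial defined as the
-- quotient (q;q)_N / ((q;q)_m (q;q)_{N-m}); by convention it is 0 when m > N.

IsShiftedGaussian : Poly → (s N m : ℕ) → Set
IsShiftedGaussian G s N m =
  (m ≤ N → G *P qPoch m *P qPoch (N ∸ m) ≈P qPow s *P qPoch N)
  × (N < m → G ≈P zeroP)

-- 1-based access to a vector (out of range indices give 0, never used)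

at : ∀ {n} → Vec ℕ n → ℕ → ℕ
at []       _             = 0
at (x ∷ xs) zero          = 0
at (x ∷ xs) (suc zero)    = x
at (x ∷ xs) (suc (suc j)) = at xs (suc j)

AllBelow : ℕ → (ℕ → Set) → Set
AllBelow n P = ∀ i → i < n → P i

AllIn1 : ℕ → (ℕ → Set) → Set
AllIn1 n P = ∀ i → 1 ≤ i → i ≤ n → P i

allBelow? : ∀ n {P : ℕ → Set} → (∀ i → Dec (P i)) → Dec (AllBelow n P)
allBelow? zero    P? = yes (λ i ())
allBelow? (suc n) P? with allBelow? n P? | P? n
... | no ¬all  | _      = no (λ all → ¬all (λ i i<n → all i (ℕP.m≤n⇒m≤1+n i<n)))
... | yes all  | no ¬pn = no (λ all′ → ¬pn (all′ n ℕP.≤-refl))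
... | yes all  | yes pn = yes λ i i<sn → helper i i<sn
  where
  helper : ∀ i → i < suc n → _
  helper i i<sn with i ℕ.≟ n
  ... | yes refl = pn
  ... | no i≢n   = all i (ℕP.≤∧≢⇒< (≤-pred i<sn) i≢n)

allIn1? : ∀ n {P : ℕ → Set} → (∀ i → Dec (P i)) → Dec (AllIn1 n P)
allIn1? n {P} P? with allBelow? n (λ j → P? (suc j))
... | yes all = yes λ { zero () _ ; (suc j) _ j<n → all j j<n }
... | no ¬all = no λ all′ → ¬all (λ j j<n → all′ (suc j) (s≤s z≤n) j<n)

module _ (a b k r : ℕ) (γ : Vec ℕ r) where

  Admissible : Vec ℕ b → Set
  Admissible Θ =
    (at Θ 1 ≤ a)
    × AllIn1 b (λ j → j < b → at Θ (suc j) ≤ at Θ j)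
    × AllBelow r (λ i → at Θ (i * k + 1) ≤ at Θ ((suc i) * k) + 1)
    -- (2)  Θ_{ck+h} - Θ_{(c+1)k+h} ≥ γ_{c+1} - γ_{c+2} for c = 0..b/k-2, h = 1..k
    --      (written additively: Θ_{(c+1)k+h} + γ_{c+1} ≤ Θ_{ck+h} + γ_{c+2})
    × AllBelow (r ∸ 1) (λ c → AllIn1 k (λ h →
        at Θ ((suc c) * k + h) + at γ (suc c) ≤ at Θ (c * k + h) + at γ (suc (suc c))))

  admissible? : (Θ : Vec ℕ b) → Dec (Admissible Θ)
  admissible? Θ =
    (at Θ 1 ≤? a)
    ×-dec allIn1? b (λ j → dec→ (j <? b) (at Θ (suc j) ≤? at Θ j))
    ×-dec allBelow? r (λ i → at Θ (i * k + 1) ≤? at Θ ((suc i) * k) + 1)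
    ×-dec allBelow? (r ∸ 1) (λ c → allIn1? k (λ h →
        at Θ ((suc c) * k + h) + at γ (suc c) ≤? at Θ (c * k + h) + at γ (suc (suc c))))
    where
    dec→ : ∀ {A B : Set} → Dec A → Dec B → Dec (A → B)
    dec→ _       (yes b) = yes (λ _ → b)
    dec→ (yes x) (no ¬b) = no (λ f → ¬b (f x))
    dec→ (no ¬a) (no _)  = yes (λ x → ⊥-elim (¬a x))

allVecs : (n a : ℕ) → List (Vec ℕ n)
allVecs zero    a = [] ∷ []
allVecs (suc n) a = concatMap (λ x → map (x ∷_) (allVecs n a)) (upTo (suc a))

sumV : ∀ {n} → Vec ℕ n → ℕ
sumV = Vec.sum

countAdm : (a b k r : ℕ) (γ : Vec ℕ r) → ℕ → ℕ
countAdm a b k r γ n =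
  length (filter (λ Θ → admissible? a b k r γ Θ ×-dec (sumV Θ ℕ.≟ n)) (allVecs b a))

-- generating function  Σ_Θ q^{Θ_1+...+Θ_b}  (degree ≤ a*b)
genFun : (a b k r : ℕ) (γ : Vec ℕ r) → Poly
genFun a b k r γ = map (λ n → + countAdm a b k r γ n) (upTo (suc (a * b)))

-- Write r = b/k and cut Θ into r blocks of k consecutive entries. Monotonicity and
-- condition (1) force each block to take at most two adjacent values, so a block is
-- determined by its sum y: its h-th entry is ⌊(y + k − h)/k⌋ (these sum to y by
-- Hermite's identity). Summing condition (2) over a block shows that the numbers
-- z_c = y_c − k γ_{c+1} decrease weakly; conversely, since γ decreases strictly,
-- balanced blocks built from any such z satisfy (1), (2) and glue monotonically.
-- So Θ ↦ z is a bijection onto the partitions with at most r parts, each at most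
-- k(a − γ_1), which lowers the weight by k Σγ. The generating function of these
-- partitions is the Gaussian polynomial [r + k(a − γ_1) choose r]_q, by the q-Pascal
-- recurrence. If a < γ_1 there is no admissible Θ at all.

module Submission where

open import Defs
open import Data.Nat using (ℕ; zero; suc; _+_; _*_; _∸_; _≤_; _<_; _≟_; _≤?_; _<?_; z≤n; s≤s; NonZero; pred; >-nonZero; >-nonZero⁻¹)
open import Data.Nat.Properties
open import Data.Nat.DivMod using (_/_; m/n≡1+[m∸n]/n; m<n⇒m/n≡0; +-distrib-/-∣ʳ; m*n/n≡m; /-monoˡ-≤; m/n*n≡m; m≥n⇒m/n>0)
open import Data.Nat.Divisibility using (_∣_; divides; ∣⇒≤)
import Data.Nat.Tactic.RingSolver as ℕ-Solver
open import Data.Integer as ℤ using (ℤ; +_)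
import Data.Integer.Properties as ℤP
open import Data.List using (List; []; _∷_; _++_; map; concatMap; upTo; applyUpTo; filter; length; [_])
import Data.List.Properties as List
open import Data.List.Membership.Propositional using (_∈_; find; lose)
open import Data.List.Membership.Propositional.Properties
  using (∈-map⁺; ∈-map⁻; ∈-concatMap⁺; ∈-concatMap⁻; ∈-upTo⁺; ∈-upTo⁻; ∈-filter⁺; ∈-filter⁻)
open import Data.List.Membership.Propositional.Properties.WithK using (unique∧set⇒bag)
open import Data.List.Relation.Binary.BagAndSetEquality using (∼bag⇒↭)
open import Data.List.Relation.Binary.Permutation.Propositional as ↭ using (_↭_)
open import Data.List.Relation.Unary.Any using (here)
import Data.List.Relation.Unary.All as ListAll
open import Data.List.Relation.Unary.Unique.Propositional using (Unique; []; _∷_)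
import Data.List.Relation.Unary.Unique.Propositional.Properties as Unique
open import Data.Maybe using (Maybe; just; nothing)
import Data.Maybe as Maybe
open import Data.Vec using (Vec; []; _∷_; zipWith; sum) renaming (_++_ to _++ᵥ_)
import Data.Vec.Properties as Vec
open import Data.Vec.Relation.Unary.All using (All; []; _∷_)
open import Data.Product using (Σ-syntax; _×_; _,_; proj₁; proj₂)
open import Data.Sum using (inj₁; inj₂)
open import Data.Empty using (⊥; ⊥-elim)
open import Function using (_∘_)
open import Function.Bundles using (mk⇔)
open import Level using (0ℓ)
open import Algebra.Bundles using (CommutativeSemigroup; CommutativeRing)
open import Algebra.Structures using (IsCommutativeMonoid)
import Algebra.Properties.CommutativeSemigroup as CommutativeSemigroupProperties
open import Relation.Binary.Structures using (IsEquivalence)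
open import Relation.Binary.Bundles using (Setoid)
import Relation.Binary.Reasoning.Setoid as SetoidReasoning
open import Relation.Nullary using (Dec; yes; no; contradiction)
open import Relation.Nullary.Decidable using (_×-dec_)
open import Relation.Unary using (Pred; Decidable)
open import Relation.Binary.PropositionalEquality hiding ([_])
open import Tactic.RingSolver using (solve-∀)
open import Tactic.RingSolver.Core.AlmostCommutativeRing using (AlmostCommutativeRing; fromCommutativeRing)

-- Wrapped in a record so that Agda can infer both polynomials from an equation.
infix 4 _≋_
record _≋_ (p q : Poly) : Set where
  constructor mk≋
  field coeff-≡ : p ≈P q
open _≋_ public

≋-refl : ∀ {p} → p ≋ p
≋-refl = mk≋ λ _ → refl

≋-sym : ∀ {p q} → p ≋ q → q ≋ p
≋-sym (mk≋ e) = mk≋ λ n → sym (e n)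

≋-trans : ∀ {p q r} → p ≋ q → q ≋ r → p ≋ r
≋-trans (mk≋ e) (mk≋ f) = mk≋ λ n → trans (e n) (f n)

≋-isEquivalence : IsEquivalence _≋_
≋-isEquivalence = record { refl = ≋-refl ; sym = ≋-sym ; trans = ≋-trans }

≋-setoid : Setoid 0ℓ 0ℓ
≋-setoid = record { isEquivalence = ≋-isEquivalence }

module ≋-Reasoning = SetoidReasoning ≋-setoid

≡⇒≋ : ∀ {p q} → p ≡ q → p ≋ q
≡⇒≋ refl = ≋-refl

coeff-+P : ∀ p q n → coeff (p +P q) n ≡ coeff p n ℤ.+ coeff q n
coeff-+P []      q       n       = sym (ℤP.+-identityˡ _)
coeff-+P (c ∷ p) []      n       = sym (ℤP.+-identityʳ _)
coeff-+P (c ∷ p) (d ∷ q) zero    = refl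
coeff-+P (c ∷ p) (d ∷ q) (suc n) = coeff-+P p q n

coeff-map : ∀ f → f (+ 0) ≡ + 0 → ∀ p n → coeff (map f p) n ≡ f (coeff p n)
coeff-map f f0 []      n       = sym f0
coeff-map f f0 (c ∷ p) zero    = refl
coeff-map f f0 (c ∷ p) (suc n) = coeff-map f f0 p n

-P_ : Poly → Poly
-P_ = map (ℤ.-_)

scale : ℤ → Poly → Poly
scale c = map (c ℤ.*_)

coeff-scale : ∀ c p n → coeff (scale c p) n ≡ c ℤ.* coeff p n
coeff-scale c = coeff-map (c ℤ.*_) (ℤP.*-zeroʳ c)

+P-cong : ∀ {p p′ q q′} → p ≋ p′ → q ≋ q′ → p +P q ≋ p′ +P q′
+P-cong {p} {p′} {q} {q′} (mk≋ e) (mk≋ f) = mk≋ λ n →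
  trans (coeff-+P p q n) (trans (cong₂ ℤ._+_ (e n) (f n)) (sym (coeff-+P p′ q′ n)))

+P-assoc : ∀ p q r → (p +P q) +P r ≋ p +P (q +P r)
+P-assoc p q r = mk≋ go
  where
  go : ∀ n → coeff ((p +P q) +P r) n ≡ coeff (p +P (q +P r)) n
  go n rewrite coeff-+P (p +P q) r n | coeff-+P p q n | coeff-+P p (q +P r) n | coeff-+P q r n =
    ℤP.+-assoc (coeff p n) (coeff q n) (coeff r n)

+P-comm : ∀ p q → p +P q ≋ q +P p
+P-comm p q = mk≋ λ n → trans (coeff-+P p q n) (trans (ℤP.+-comm (coeff p n) (coeff q n)) (sym (coeff-+P q p n)))

+P-identityʳ : ∀ p → p +P zeroP ≋ p
+P-identityʳ p = mk≋ λ n → trans (coeff-+P p [] n) (ℤP.+-identityʳ (coeff p n))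

+P-isCommutativeMonoid : IsCommutativeMonoid _≋_ _+P_ zeroP
+P-isCommutativeMonoid = record
  { isMonoid = record
    { isSemigroup = record
      { isMagma = record { isEquivalence = ≋-isEquivalence ; ∙-cong = +P-cong }
      ; assoc   = +P-assoc }
    ; identity = (λ _ → ≋-refl) , +P-identityʳ }
  ; comm = +P-comm }

+P-commutativeSemigroup : CommutativeSemigroup 0ℓ 0ℓ
+P-commutativeSemigroup = record
  { isCommutativeSemigroup = IsCommutativeMonoid.isCommutativeSemigroup +P-isCommutativeMonoid }

open CommutativeSemigroupProperties +P-commutativeSemigroup public
  using () renaming (interchange to +P-interchange; x∙yz≈y∙xz to +P-swap)

-P-cong : ∀ {p q} → p ≋ q → -P p ≋ -P q
-P-cong {p} {q} (mk≋ e) = mk≋ λ n → trans (coeff-map (ℤ.-_) refl p n) (trans (cong (ℤ.-_) (e n)) (sym (coeff-map (ℤ.-_) refl q n)))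

-P-inverseˡ : ∀ p → (-P p) +P p ≋ zeroP
-P-inverseˡ p = mk≋ λ n → trans (coeff-+P (-P p) p n) (trans (cong (ℤ._+ coeff p n) (coeff-map (ℤ.-_) refl p n)) (ℤP.+-inverseˡ (coeff p n)))

scale-cong : ∀ c {p p′} → p ≋ p′ → scale c p ≋ scale c p′
scale-cong c {p} {p′} (mk≋ e) = mk≋ λ n → trans (coeff-scale c p n) (trans (cong (c ℤ.*_) (e n)) (sym (coeff-scale c p′ n)))

scale-distribˡ : ∀ c p q → scale c (p +P q) ≋ scale c p +P scale c q
scale-distribˡ c p q = mk≋ go
  where
  go : ∀ n → coeff (scale c (p +P q)) n ≡ coeff (scale c p +P scale c q) n
  go n rewrite coeff-scale c (p +P q) n | coeff-+P p q n | coeff-+P (scale c p) (scale c q) n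
             | coeff-scale c p n | coeff-scale c q n = ℤP.*-distribˡ-+ c (coeff p n) (coeff q n)

scale-distribʳ : ∀ c d p → scale (c ℤ.+ d) p ≋ scale c p +P scale d p
scale-distribʳ c d p = mk≋ go
  where
  go : ∀ n → coeff (scale (c ℤ.+ d) p) n ≡ coeff (scale c p +P scale d p) n
  go n rewrite coeff-scale (c ℤ.+ d) p n | coeff-+P (scale c p) (scale d p) n
             | coeff-scale c p n | coeff-scale d p n = ℤP.*-distribʳ-+ (coeff p n) c d

scale-assoc : ∀ c d p → scale c (scale d p) ≋ scale (c ℤ.* d) p
scale-assoc c d p = mk≋ go
  where
  go : ∀ n → coeff (scale c (scale d p)) n ≡ coeff (scale (c ℤ.* d) p) n
  go n rewrite coeff-scale c (scale d p) n | coeff-scale d p n | coeff-scale (c ℤ.* d) p n =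
    sym (ℤP.*-assoc c d (coeff p n))

scale-identity : ∀ p → scale (+ 1) p ≋ p
scale-identity p = mk≋ λ n → trans (coeff-scale (+ 1) p n) (ℤP.*-identityˡ (coeff p n))

scale-zero : ∀ p → scale (+ 0) p ≋ zeroP
scale-zero p = mk≋ (coeff-scale (+ 0) p)

∷-cong : ∀ c {p p′} → p ≋ p′ → c ∷ p ≋ c ∷ p′
∷-cong c (mk≋ e) = mk≋ λ { zero → refl ; (suc n) → e n }

[0]≋zeroP : + 0 ∷ [] ≋ zeroP
[0]≋zeroP = mk≋ λ { zero → refl ; (suc n) → refl }

-- _*P_ recurses on its left argument only: commutativity comes from *P-shiftʳ,
-- and congruence on the left from commutativity.

*P-zeroʳ : ∀ p → p *P zeroP ≋ zeroP
*P-zeroʳ []      = ≋-refl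
*P-zeroʳ (c ∷ p) = ≋-trans (∷-cong _ (*P-zeroʳ p)) [0]≋zeroP

*P-congʳ : ∀ p {q q′} → q ≋ q′ → p *P q ≋ p *P q′
*P-congʳ []      e = ≋-refl
*P-congʳ (c ∷ p) e = +P-cong (scale-cong c e) (∷-cong _ (*P-congʳ p e))

*P-shiftʳ : ∀ p d q → p *P (d ∷ q) ≋ scale d p +P (+ 0 ∷ p *P q)
*P-shiftʳ []      d q = ≋-sym [0]≋zeroP
*P-shiftʳ (c ∷ p) d q = mk≋ λ
  { zero    → trans (ℤP.+-identityʳ _) (trans (ℤP.*-comm c d) (sym (ℤP.+-identityʳ _)))
  ; (suc n) → coeff-≡ (≋-trans (+P-cong (≋-refl {scale c q}) (*P-shiftʳ p d q))
                               (+P-swap (scale c q) (scale d p) (+ 0 ∷ p *P q))) n }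

*P-comm : ∀ p q → p *P q ≋ q *P p
*P-comm []      q = ≋-sym (*P-zeroʳ q)
*P-comm (c ∷ p) q = ≋-trans (+P-cong (≋-refl {scale c q}) (∷-cong _ (*P-comm p q))) (≋-sym (*P-shiftʳ q c p))

*P-congˡ : ∀ {p p′} q → p ≋ p′ → p *P q ≋ p′ *P q
*P-congˡ {p} {p′} q e = ≋-trans (*P-comm p q) (≋-trans (*P-congʳ q e) (*P-comm q p′))

*P-cong : ∀ {p p′ q q′} → p ≋ p′ → q ≋ q′ → p *P q ≋ p′ *P q′
*P-cong {p′ = p′} {q} e f = ≋-trans (*P-congˡ q e) (*P-congʳ p′ f)

*P-distribʳ : ∀ q p p′ → (p +P p′) *P q ≋ p *P q +P p′ *P q
*P-distribʳ q []      p′        = ≋-refl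
*P-distribʳ q (c ∷ p) []        = ≋-sym (+P-identityʳ _)
*P-distribʳ q (c ∷ p) (c′ ∷ p′) =
  ≋-trans (+P-cong (scale-distribʳ c c′ q) (∷-cong (+ 0) (*P-distribʳ q p p′)))
          (+P-interchange (scale c q) (scale c′ q) (+ 0 ∷ p *P q) (+ 0 ∷ p′ *P q))

*P-distribˡ : ∀ p q q′ → p *P (q +P q′) ≋ p *P q +P p *P q′
*P-distribˡ p q q′ = ≋-trans (*P-comm p (q +P q′))
  (≋-trans (*P-distribʳ p q q′) (+P-cong (*P-comm q p) (*P-comm q′ p)))

scale-*P : ∀ c p q → scale c p *P q ≋ scale c (p *P q)
scale-*P c []      q = ≋-refl
scale-*P c (d ∷ p) q =
  ≋-trans (+P-cong (≋-sym (scale-assoc c d q)) (∷-cong (+ 0) (scale-*P c p q)))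
  (≋-trans (+P-cong (≋-refl {scale c (scale d q)}) (mk≋ λ { zero → sym (ℤP.*-zeroʳ c) ; (suc n) → refl }))
           (≋-sym (scale-distribˡ c (scale d q) (+ 0 ∷ p *P q))))

*P-shiftˡ : ∀ p q → (+ 0 ∷ p) *P q ≋ + 0 ∷ p *P q
*P-shiftˡ p q = +P-cong (scale-zero q) ≋-refl

*P-assoc : ∀ p q r → (p *P q) *P r ≋ p *P (q *P r)
*P-assoc []      q r = ≋-refl
*P-assoc (c ∷ p) q r = ≋-trans (*P-distribʳ r (scale c q) (+ 0 ∷ p *P q))
  (+P-cong (scale-*P c q r) (≋-trans (*P-shiftˡ (p *P q) r) (∷-cong (+ 0) (*P-assoc p q r))))

*P-identityˡ : ∀ q → oneP *P q ≋ q
*P-identityˡ q = ≋-trans (+P-cong (scale-identity q) ≋-refl)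
  (≋-trans (+P-cong (≋-refl {q}) [0]≋zeroP) (+P-identityʳ q))

*P-identityʳ : ∀ q → q *P oneP ≋ q
*P-identityʳ q = ≋-trans (*P-comm q oneP) (*P-identityˡ q)

Poly-commutativeRing : CommutativeRing 0ℓ 0ℓ
Poly-commutativeRing = record
  { Carrier = Poly ; _≈_ = _≋_ ; _+_ = _+P_ ; _*_ = _*P_ ; -_ = -P_ ; 0# = zeroP ; 1# = oneP
  ; isCommutativeRing = record
    { isRing = record
      { +-isAbelianGroup = record
        { isGroup = record
          { isMonoid = IsCommutativeMonoid.isMonoid +P-isCommutativeMonoid
          ; inverse  = -P-inverseˡ , λ p → ≋-trans (+P-comm p (-P p)) (-P-inverseˡ p)
          ; ⁻¹-cong  = -P-cong }
        ; comm = +P-comm }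
      ; *-cong     = *P-cong
      ; *-assoc    = *P-assoc
      ; *-identity = *P-identityˡ , *P-identityʳ
      ; distrib    = *P-distribˡ , *P-distribʳ }
    ; *-comm = *P-comm } }

zeroP≟ : ∀ p → Maybe (zeroP ≋ p)
zeroP≟ []        = just ≋-refl
zeroP≟ (+ 0 ∷ p) = Maybe.map (λ e → ≋-trans (≋-sym [0]≋zeroP) (∷-cong (+ 0) e)) (zeroP≟ p)
zeroP≟ _         = nothing

-- The solver normalises constant coefficients by computation, so it must recognise
-- coefficient lists such as [+ 0] as zero.
Poly-almostCommutativeRing : AlmostCommutativeRing _ _
Poly-almostCommutativeRing = fromCommutativeRing Poly-commutativeRing zeroP≟

qPow-+ : ∀ i j → qPow (i + j) ≋ qPow i *P qPow j
qPow-+ zero    j = ≋-sym (*P-identityˡ (qPow j))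
qPow-+ (suc i) j = ≋-trans (∷-cong (+ 0) (qPow-+ i j)) (≋-sym (*P-shiftˡ (qPow i) (qPow j)))

oneMinusQPow-+ : ∀ i j → oneMinusQPow i +P qPow i *P oneMinusQPow j ≋ oneMinusQPow (i + j)
oneMinusQPow-+ i j = ≋-trans (expand (qPow i) (qPow j)) (+P-cong ≋-refl (-P-cong (≋-sym (qPow-+ i j))))
  where
  expand : ∀ x y → oneP +P -P x +P x *P (oneP +P -P y) ≋ oneP +P -P (x *P y)
  expand = solve-∀ Poly-almostCommutativeRing

gf : ∀ {n} → List (Vec ℕ n) → Poly
gf []      = zeroP
gf (v ∷ L) = qPow (sumV v) +P gf L

gf-++ : ∀ {n} (L L′ : List (Vec ℕ n)) → gf (L ++ L′) ≋ gf L +P gf L′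
gf-++ []      L′ = ≋-refl
gf-++ (v ∷ L) L′ = ≋-trans (+P-cong (≋-refl {qPow (sumV v)}) (gf-++ L L′)) (≋-sym (+P-assoc (qPow (sumV v)) (gf L) (gf L′)))

gf-map : ∀ {m n} (f : Vec ℕ m → Vec ℕ n) s → (∀ v → sumV (f v) ≡ s + sumV v) →
         ∀ L → gf (map f L) ≋ qPow s *P gf L
gf-map f s sum-f []      = ≋-sym (*P-zeroʳ (qPow s))
gf-map f s sum-f (v ∷ L) = begin
  qPow (sumV (f v)) +P gf (map f L)    ≈⟨ +P-cong (≡⇒≋ (cong qPow (sum-f v))) (gf-map f s sum-f L) ⟩
  qPow (s + sumV v) +P qPow s *P gf L  ≈⟨ +P-cong (qPow-+ s (sumV v)) ≋-refl ⟩
  qPow s *P qPow (sumV v) +P qPow s *P gf L ≈⟨ ≋-sym (*P-distribˡ (qPow s) (qPow (sumV v)) (gf L)) ⟩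
  qPow s *P gf (v ∷ L)                 ∎
  where open ≋-Reasoning

gf-↭ : ∀ {n} {L L′ : List (Vec ℕ n)} → L ↭ L′ → gf L ≋ gf L′
gf-↭ ↭.refl              = ≋-refl
gf-↭ (↭.prep v p)        = +P-cong (≋-refl {qPow (sumV v)}) (gf-↭ p)
gf-↭ (↭.swap {ys = L′} v w p) =
  ≋-trans (+P-cong (≋-refl {qPow (sumV v)}) (+P-cong (≋-refl {qPow (sumV w)}) (gf-↭ p)))
          (+P-swap (qPow (sumV v)) (qPow (sumV w)) (gf L′))
gf-↭ (↭.trans p p′)      = ≋-trans (gf-↭ p) (gf-↭ p′)

coeff-qPow-≡ : ∀ {s n} → s ≡ n → coeff (qPow s) n ≡ + 1
coeff-qPow-≡ {zero}  refl = refl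
coeff-qPow-≡ {suc s} refl = coeff-qPow-≡ {s} refl

coeff-qPow-≢ : ∀ {s n} → s ≢ n → coeff (qPow s) n ≡ + 0
coeff-qPow-≢ {zero}  {zero}  s≢n = ⊥-elim (s≢n refl)
coeff-qPow-≢ {zero}  {suc n} s≢n = refl
coeff-qPow-≢ {suc s} {zero}  s≢n = refl
coeff-qPow-≢ {suc s} {suc n} s≢n = coeff-qPow-≢ (s≢n ∘ cong suc)

coeff-gf : ∀ {m} (L : List (Vec ℕ m)) n → coeff (gf L) n ≡ + length (filter (λ v → sumV v ≟ n) L)
coeff-gf []      n = refl
coeff-gf (v ∷ L) n with sumV v ≟ n
... | yes s≡n = begin
  coeff (qPow (sumV v) +P gf L) n                ≡⟨ coeff-+P (qPow (sumV v)) (gf L) n ⟩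
  coeff (qPow (sumV v)) n ℤ.+ coeff (gf L) n     ≡⟨ cong₂ ℤ._+_ (coeff-qPow-≡ s≡n) (coeff-gf L n) ⟩
  + suc (length (filter (λ w → sumV w ≟ n) L))   ≡⟨ cong (+_ ∘ length) (List.filter-accept (λ w → sumV w ≟ n) {v} {L} s≡n) ⟨
  + length (filter (λ w → sumV w ≟ n) (v ∷ L))   ∎
  where open ≡-Reasoning
... | no s≢n = begin
  coeff (qPow (sumV v) +P gf L) n                ≡⟨ coeff-+P (qPow (sumV v)) (gf L) n ⟩
  coeff (qPow (sumV v)) n ℤ.+ coeff (gf L) n     ≡⟨ cong₂ ℤ._+_ (coeff-qPow-≢ s≢n) (coeff-gf L n) ⟩
  + length (filter (λ w → sumV w ≟ n) L)         ≡⟨ cong (+_ ∘ length) (List.filter-reject (λ w → sumV w ≟ n) {v} {L} s≢n) ⟨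
  + length (filter (λ w → sumV w ≟ n) (v ∷ L))   ∎
  where open ≡-Reasoning

↭-unique : ∀ {A : Set} {xs ys : List A} → Unique xs → Unique ys →
           (∀ {z} → z ∈ xs → z ∈ ys) → (∀ {z} → z ∈ ys → z ∈ xs) → xs ↭ ys
↭-unique ux uy xs⊆ys ys⊆xs = ∼bag⇒↭ (unique∧set⇒bag ux uy (mk⇔ xs⊆ys ys⊆xs))

module _ {n : ℕ} (F : ℕ → List (Vec ℕ n)) where

  consEach : List ℕ → List (Vec ℕ (suc n))
  consEach = concatMap (λ x → map (x ∷_) (F x))

  ∈-consEach⁻ : ∀ {xs x u} → x ∷ u ∈ consEach xs → x ∈ xs × u ∈ F x
  ∈-consEach⁻ p with find (∈-concatMap⁻ (λ x → map (x ∷_) (F x)) p)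
  ... | y , y∈xs , q with ∈-map⁻ (y ∷_) q
  ... | u , u∈ , refl = y∈xs , u∈

  ∈-consEach⁺ : ∀ {xs x u} → x ∈ xs → u ∈ F x → x ∷ u ∈ consEach xs
  ∈-consEach⁺ x∈xs u∈ = ∈-concatMap⁺ (λ x → map (x ∷_) (F x)) (lose x∈xs (∈-map⁺ (_ ∷_) u∈))

  consEach-unique : ∀ {xs} → Unique xs → (∀ x → Unique (F x)) → Unique (consEach xs)
  consEach-unique []         uF = []
  consEach-unique {x ∷ xs} (x∉ ∷ uxs) uF =
    Unique.++⁺ (Unique.map⁺ ∷-injectiveʳ (uF x)) (consEach-unique uxs uF) disjoint
    where
    ∷-injectiveʳ : ∀ {u v : Vec ℕ n} → x ∷ u ≡ x ∷ v → u ≡ v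
    ∷-injectiveʳ refl = refl
    disjoint : ∀ {v} → v ∈ map (x ∷_) (F x) × v ∈ consEach xs → ⊥
    disjoint (p , q) with ∈-map⁻ (x ∷_) p
    ... | u , _ , refl = ListAll.lookup x∉ (proj₁ (∈-consEach⁻ q)) refl

allVecs-unique : ∀ n a → Unique (allVecs n a)
allVecs-unique zero    a = ListAll.[] ∷ []
allVecs-unique (suc n) a = consEach-unique (λ _ → allVecs n a) (Unique.upTo⁺ (suc a)) (λ _ → allVecs-unique n a)

∈-allVecs⁻ : ∀ {n a} {v : Vec ℕ n} → v ∈ allVecs n a → All (_≤ a) v
∈-allVecs⁻ {zero}  {v = []}    _ = []
∈-allVecs⁻ {suc n} {v = x ∷ v} p with ∈-consEach⁻ (λ _ → allVecs n _) p
... | x∈ , v∈ = ≤-pred (∈-upTo⁻ x∈) ∷ ∈-allVecs⁻ v∈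

∈-allVecs⁺ : ∀ {n a} {v : Vec ℕ n} → All (_≤ a) v → v ∈ allVecs n a
∈-allVecs⁺ {zero}  []          = here refl
∈-allVecs⁺ {suc n} (x≤a ∷ v≤a) = ∈-consEach⁺ (λ _ → allVecs n _) (∈-upTo⁺ (s≤s x≤a)) (∈-allVecs⁺ v≤a)

data Descending (M : ℕ) : ∀ {r} → Vec ℕ r → Set where
  []  : Descending M []
  _∷_ : ∀ {r x} {v : Vec ℕ r} → x ≤ M → Descending x v → Descending M (x ∷ v)

partitions : (r M : ℕ) → List (Vec ℕ r)
partitions zero    M = [ [] ]
partitions (suc r) M = consEach (partitions r) (upTo (suc M))

partitions-unique : ∀ r M → Unique (partitions r M)
partitions-unique zero    M = ListAll.[] ∷ []
partitions-unique (suc r) M = consEach-unique (partitions r) (Unique.upTo⁺ (suc M)) (partitions-unique r)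

∈-partitions⁻ : ∀ {r M} {v : Vec ℕ r} → v ∈ partitions r M → Descending M v
∈-partitions⁻ {zero}  {v = []}    _ = []
∈-partitions⁻ {suc r} {v = x ∷ v} p with ∈-consEach⁻ (partitions r) p
... | x∈ , v∈ = ≤-pred (∈-upTo⁻ x∈) ∷ ∈-partitions⁻ v∈

∈-partitions⁺ : ∀ {r M} {v : Vec ℕ r} → Descending M v → v ∈ partitions r M
∈-partitions⁺ {zero}  []          = here refl
∈-partitions⁺ {suc r} (x≤M ∷ dv) = ∈-consEach⁺ (partitions r) (∈-upTo⁺ (s≤s x≤M)) (∈-partitions⁺ dv)

filter-×-dec : ∀ {A : Set} {P Q : Pred A 0ℓ} (P? : Decidable P) (Q? : Decidable Q) xs →
               filter (λ x → P? x ×-dec Q? x) xs ≡ filter Q? (filter P? xs)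
filter-×-dec P? Q? []       = refl
filter-×-dec {P = P} {Q} P? Q? (x ∷ xs) = by-cases (P? x) (Q? x)
  where
  PQ? = λ x → P? x ×-dec Q? x
  by-cases : Dec (P x) → Dec (Q x) → filter PQ? (x ∷ xs) ≡ filter Q? (filter P? (x ∷ xs))
  by-cases (yes p) (yes q) = begin
    filter PQ? (x ∷ xs)            ≡⟨ List.filter-accept PQ? (p , q) ⟩
    x ∷ filter PQ? xs              ≡⟨ cong (x ∷_) (filter-×-dec P? Q? xs) ⟩
    x ∷ filter Q? (filter P? xs)   ≡⟨ List.filter-accept Q? q ⟨
    filter Q? (x ∷ filter P? xs)   ≡⟨ cong (filter Q?) (List.filter-accept P? p) ⟨
    filter Q? (filter P? (x ∷ xs)) ∎
    where open ≡-Reasoning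
  by-cases (yes p) (no ¬q) = begin
    filter PQ? (x ∷ xs)            ≡⟨ List.filter-reject PQ? (¬q ∘ proj₂) ⟩
    filter PQ? xs                  ≡⟨ filter-×-dec P? Q? xs ⟩
    filter Q? (filter P? xs)       ≡⟨ List.filter-reject Q? ¬q ⟨
    filter Q? (x ∷ filter P? xs)   ≡⟨ cong (filter Q?) (List.filter-accept P? p) ⟨
    filter Q? (filter P? (x ∷ xs)) ∎
    where open ≡-Reasoning
  by-cases (no ¬p) _ = begin
    filter PQ? (x ∷ xs)            ≡⟨ List.filter-reject PQ? (¬p ∘ proj₁) ⟩
    filter PQ? xs                  ≡⟨ filter-×-dec P? Q? xs ⟩
    filter Q? (filter P? xs)       ≡⟨ cong (filter Q?) (List.filter-reject P? ¬p) ⟨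
    filter Q? (filter P? (x ∷ xs)) ∎
    where open ≡-Reasoning

coeff-applyUpTo : ∀ f m n → (m ≤ n → f n ≡ + 0) → coeff (applyUpTo f m) n ≡ f n
coeff-applyUpTo f zero    n       vanish = sym (vanish z≤n)
coeff-applyUpTo f (suc m) zero    _      = refl
coeff-applyUpTo f (suc m) (suc n) vanish = coeff-applyUpTo (f ∘ suc) m n (vanish ∘ s≤s)

sum-≤ : ∀ {n a} {v : Vec ℕ n} → All (_≤ a) v → sumV v ≤ n * a
sum-≤ []          = z≤n
sum-≤ (x≤a ∷ v≤a) = +-mono-≤ x≤a (sum-≤ v≤a)

genFun-gf : ∀ a b k r (γ : Vec ℕ r) → genFun a b k r γ ≋ gf (filter (admissible? a b k r γ) (allVecs b a))
genFun-gf a b k r γ = mk≋ λ n → begin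
  coeff (map (λ n → + countAdm a b k r γ n) (upTo (suc (a * b)))) n
    ≡⟨ cong (λ p → coeff p n) (List.map-applyUpTo (λ i → i) _ (suc (a * b))) ⟩
  coeff (applyUpTo (λ n → + countAdm a b k r γ n) (suc (a * b))) n
    ≡⟨ coeff-applyUpTo (λ n → + countAdm a b k r γ n) (suc (a * b)) n (cong +_ ∘ count-vanishes) ⟩
  + countAdm a b k r γ n
    ≡⟨ cong (+_ ∘ length) (filter-×-dec (admissible? a b k r γ) (λ v → sumV v ≟ n) (allVecs b a)) ⟩
  + length (filter (λ v → sumV v ≟ n) (filter (admissible? a b k r γ) (allVecs b a)))
    ≡⟨ coeff-gf (filter (admissible? a b k r γ) (allVecs b a)) n ⟨
  coeff (gf (filter (admissible? a b k r γ) (allVecs b a))) n ∎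
  where
  open ≡-Reasoning
  count-vanishes : ∀ {n} → suc (a * b) ≤ n → countAdm a b k r γ n ≡ 0
  count-vanishes {n} ab<n = cong length (List.filter-none (λ Θ → admissible? a b k r γ Θ ×-dec sumV Θ ≟ n) (ListAll.tabulate λ {v} v∈ (_ , sum≡n) →
    <⇒≱ ab<n (subst (_≤ a * b) sum≡n (≤-trans (sum-≤ (∈-allVecs⁻ v∈)) (≤-reflexive (*-comm b a))))))

-- The Gaussian polynomial counts partitions in a box

partitions-suc : ∀ r M →
  partitions (suc r) (suc M) ≡ partitions (suc r) M ++ map (suc M ∷_) (partitions r (suc M))
partitions-suc r M = begin
  concatMap F (upTo (suc (suc M)))              ≡⟨ cong (concatMap F) (sym (List.upTo-∷ʳ (suc M))) ⟩
  concatMap F (upTo (suc M) ++ [ suc M ])       ≡⟨ List.concatMap-++ F (upTo (suc M)) [ suc M ] ⟩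
  concatMap F (upTo (suc M)) ++ (F (suc M) ++ []) ≡⟨ cong (concatMap F (upTo (suc M)) ++_) (List.++-identityʳ (F (suc M))) ⟩
  concatMap F (upTo (suc M)) ++ F (suc M)       ∎
  where
  open ≡-Reasoning
  F = λ x → map (x ∷_) (partitions r x)

gf-partitions-suc : ∀ r M →
  gf (partitions (suc r) (suc M)) ≋ gf (partitions (suc r) M) +P qPow (suc M) *P gf (partitions r (suc M))
gf-partitions-suc r M =
  ≋-trans (≡⇒≋ (cong gf (partitions-suc r M)))
  (≋-trans (gf-++ (partitions (suc r) M) _)
           (+P-cong ≋-refl (gf-map (suc M ∷_) (suc M) (λ _ → refl) (partitions r (suc M)))))

gf-partitions-zero : ∀ r → gf (partitions r 0) ≋ oneP
gf-partitions-zero zero    = ≋-refl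
gf-partitions-zero (suc r) =
  ≋-trans (≡⇒≋ (cong gf (List.++-identityʳ (map (0 ∷_) (partitions r 0)))))
  (≋-trans (gf-map (0 ∷_) 0 (λ _ → refl) (partitions r 0))
  (≋-trans (*P-identityˡ _) (gf-partitions-zero r)))

gf-partitions-qPoch : ∀ r M → gf (partitions r M) *P qPoch r *P qPoch M ≋ qPoch (r + M)
gf-partitions-qPoch zero    M    = ≋-trans (*P-congˡ (qPoch M) (*P-identityˡ oneP)) (*P-identityˡ (qPoch M))
gf-partitions-qPoch (suc r) zero = begin
  gf (partitions (suc r) 0) *P qPoch (suc r) *P oneP ≈⟨ *P-identityʳ _ ⟩
  gf (partitions (suc r) 0) *P qPoch (suc r)         ≈⟨ *P-congˡ (qPoch (suc r)) (gf-partitions-zero (suc r)) ⟩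
  oneP *P qPoch (suc r)                              ≈⟨ *P-identityˡ (qPoch (suc r)) ⟩
  qPoch (suc r)                                      ≡⟨ cong qPoch (sym (+-identityʳ (suc r))) ⟩
  qPoch (suc r + 0)                                  ∎
  where open ≋-Reasoning
gf-partitions-qPoch (suc r) (suc M) = begin
  gf (partitions (suc r) (suc M)) *P (Pr *P Er) *P (PM *P EM)
    ≈⟨ *P-congˡ (PM *P EM) (*P-congˡ (Pr *P Er) (gf-partitions-suc r M)) ⟩
  (A +P X *P B) *P (Pr *P Er) *P (PM *P EM)
    ≈⟨ expand A B X Pr Er PM EM ⟩
  A *P (Pr *P Er) *P PM *P EM +P X *P Er *P (B *P Pr *P (PM *P EM))
    ≈⟨ +P-cong (*P-congˡ EM IH₁) (*P-congʳ (X *P Er) (gf-partitions-qPoch r (suc M))) ⟩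
  T *P EM +P X *P Er *P T
    ≈⟨ factor T EM (X *P Er) ⟩
  T *P (EM +P X *P Er)
    ≈⟨ *P-congʳ T (oneMinusQPow-+ (suc M) (suc r)) ⟩
  T *P oneMinusQPow (suc M + suc r)
    ≡⟨ cong (λ n → T *P oneMinusQPow n) (+-comm (suc M) (suc r)) ⟩
  qPoch (suc r + suc M) ∎
  where
  open ≋-Reasoning
  A = gf (partitions (suc r) M)
  B = gf (partitions r (suc M))
  X = qPow (suc M)
  Pr = qPoch r
  Er = oneMinusQPow (suc r)
  PM = qPoch M
  EM = oneMinusQPow (suc M)
  T = qPoch (r + suc M)
  IH₁ : A *P (Pr *P Er) *P PM ≋ T
  IH₁ = ≋-trans (gf-partitions-qPoch (suc r) M) (≡⇒≋ (cong qPoch (sym (+-suc r M))))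
  expand : ∀ A B X Pr Er PM EM →
    (A +P X *P B) *P (Pr *P Er) *P (PM *P EM) ≋ A *P (Pr *P Er) *P PM *P EM +P X *P Er *P (B *P Pr *P (PM *P EM))
  expand = solve-∀ Poly-almostCommutativeRing
  factor : ∀ T E F → T *P E +P F *P T ≋ T *P (E +P F)
  factor = solve-∀ Poly-almostCommutativeRing

isShiftedGaussian-partitions : ∀ {G} s r M → G ≋ qPow s *P gf (partitions r M) → IsShiftedGaussian G s (r + M) r
isShiftedGaussian-partitions {G} s r M G≋ = (λ _ → coeff-≡ identity) , (λ r+M<r → contradiction r+M<r (≤⇒≯ (m≤m+n r M)))
  where
  open ≋-Reasoning
  reassociate : ∀ X P Q R → X *P P *P Q *P R ≋ X *P (P *P Q *P R)
  reassociate = solve-∀ Poly-almostCommutativeRing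
  identity : G *P qPoch r *P qPoch (r + M ∸ r) ≋ qPow s *P qPoch (r + M)
  identity = begin
    G *P qPoch r *P qPoch (r + M ∸ r)                        ≡⟨ cong (λ n → G *P qPoch r *P qPoch n) (m+n∸m≡n r M) ⟩
    G *P qPoch r *P qPoch M                                  ≈⟨ *P-congˡ (qPoch M) (*P-congˡ (qPoch r) G≋) ⟩
    qPow s *P gf (partitions r M) *P qPoch r *P qPoch M      ≈⟨ reassociate (qPow s) (gf (partitions r M)) (qPoch r) (qPoch M) ⟩
    qPow s *P (gf (partitions r M) *P qPoch r *P qPoch M)    ≈⟨ *P-congʳ (qPow s) (gf-partitions-qPoch r M) ⟩
    qPow s *P qPoch (r + M)                                  ∎

isShiftedGaussian-zero : ∀ {G} s {N m} → N < m → G ≋ zeroP → IsShiftedGaussian G s N m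
isShiftedGaussian-zero s N<m G≋0 = (λ m≤N → contradiction m≤N (<⇒≱ N<m)) , λ _ → coeff-≡ G≋0

-- Balanced sequences

sum₁ : ℕ → (ℕ → ℕ) → ℕ
sum₁ zero    f = 0
sum₁ (suc n) f = f 1 + sum₁ n (f ∘ suc)

sum₁-cong : ∀ n {f g} → AllIn1 n (λ i → f i ≡ g i) → sum₁ n f ≡ sum₁ n g
sum₁-cong zero    f≡g = refl
sum₁-cong (suc n) f≡g = cong₂ _+_ (f≡g 1 ≤-refl (s≤s z≤n)) (sum₁-cong n λ i 1≤i i≤n → f≡g (suc i) (s≤s z≤n) (s≤s i≤n))

sum₁-mono-≤ : ∀ n {f g} → AllIn1 n (λ i → f i ≤ g i) → sum₁ n f ≤ sum₁ n g
sum₁-mono-≤ zero    f≤g = z≤n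
sum₁-mono-≤ (suc n) f≤g = +-mono-≤ (f≤g 1 ≤-refl (s≤s z≤n)) (sum₁-mono-≤ n λ i 1≤i i≤n → f≤g (suc i) (s≤s z≤n) (s≤s i≤n))

sum₁-mono-< : ∀ n {f g} → AllIn1 n (λ i → f i ≤ g i) → ∀ h → 1 ≤ h → h ≤ n → f h < g h → sum₁ n f < sum₁ n g
sum₁-mono-< (suc n) f≤g (suc zero)    _ _         fh<gh =
  +-mono-<-≤ fh<gh (sum₁-mono-≤ n λ i 1≤i i≤n → f≤g (suc i) (s≤s z≤n) (s≤s i≤n))
sum₁-mono-< (suc n) f≤g (suc (suc h)) _ (s≤s h≤n) fh<gh =
  +-mono-≤-< (f≤g 1 ≤-refl (s≤s z≤n)) (sum₁-mono-< n (λ i 1≤i i≤n → f≤g (suc i) (s≤s z≤n) (s≤s i≤n)) (suc h) (s≤s z≤n) h≤n fh<gh)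

sum₁-snoc : ∀ n f → sum₁ (suc n) f ≡ sum₁ n f + f (suc n)
sum₁-snoc zero    f = +-comm (f 1) 0
sum₁-snoc (suc n) f = trans (cong (_+_ (f 1)) (sum₁-snoc n (f ∘ suc))) (sym (+-assoc (f 1) _ _))

sum₁-const : ∀ n c → sum₁ n (λ _ → c) ≡ n * c
sum₁-const zero    c = refl
sum₁-const (suc n) c = cong (_+_ c) (sum₁-const n c)

sum₁-+-const : ∀ n f c → sum₁ n (λ i → f i + c) ≡ sum₁ n f + n * c
sum₁-+-const zero    f c = refl
sum₁-+-const (suc n) f c = trans (cong (_+_ (f 1 + c)) (sum₁-+-const n (f ∘ suc) c)) (regroup (f 1) c (sum₁ n (f ∘ suc)) (n * c))
  where
  regroup : ∀ a c s t → a + c + (s + t) ≡ a + s + (c + t)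
  regroup = ℕ-Solver.solve-∀

Balanced : ℕ → (ℕ → ℕ) → Set
Balanced k f = AllIn1 k (λ h → h < k → f (suc h) ≤ f h) × f 1 ≤ suc (f k)

balanced-antitone : ∀ {k f} → Balanced k f → ∀ {i j} → 1 ≤ i → i ≤ j → j ≤ k → f j ≤ f i
balanced-antitone {k} {f} (step , _) {i} 1≤i i≤j j≤k with m≤n⇒∃[o]m+o≡n i≤j
... | d , refl = go d j≤k
  where
  go : ∀ d → i + d ≤ k → f (i + d) ≤ f i
  go zero    _   = ≤-reflexive (cong f (+-identityʳ i))
  go (suc d) i+d<k rewrite +-suc i d =
    ≤-trans (step (i + d) (≤-trans 1≤i (m≤m+n i d)) (<⇒≤ i+d<k) i+d<k) (go d (<⇒≤ i+d<k))

-- A balanced sequence takes at most two adjacent values, so g h < f h forces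
-- g ≤ f everywhere, and then the sums are strictly ordered.
balanced-≤ : ∀ {k f g} → Balanced k f → Balanced k g → sum₁ k f ≤ sum₁ k g → AllIn1 k (λ h → f h ≤ g h)
balanced-≤ {k} {f} {g} bf bg Σf≤Σg h 1≤h h≤k with f h ≤? g h
... | yes fh≤gh = fh≤gh
... | no  fh≰gh = contradiction Σf≤Σg (<⇒≱ (sum₁-mono-< k g≤f h 1≤h h≤k gh<fh))
  where
  gh<fh : g h < f h
  gh<fh = ≰⇒> fh≰gh
  g≤f : AllIn1 k (λ i → g i ≤ f i)
  g≤f i 1≤i i≤k with ≤-total i h
  ... | inj₁ i≤h = begin
    g i        ≤⟨ balanced-antitone bg ≤-refl 1≤i i≤k ⟩
    g 1        ≤⟨ proj₂ bg ⟩
    suc (g k)  ≤⟨ s≤s (balanced-antitone bg 1≤h h≤k ≤-refl) ⟩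
    suc (g h)  ≤⟨ gh<fh ⟩
    f h        ≤⟨ balanced-antitone bf 1≤i i≤h h≤k ⟩
    f i        ∎
    where open ≤-Reasoning
  ... | inj₂ h≤i = ≤-pred (begin-strict
    g i        ≤⟨ balanced-antitone bg 1≤h h≤i i≤k ⟩
    g h        <⟨ gh<fh ⟩
    f h        ≤⟨ balanced-antitone bf ≤-refl 1≤h h≤k ⟩
    f 1        ≤⟨ proj₂ bf ⟩
    suc (f k)  ≤⟨ s≤s (balanced-antitone bf 1≤i i≤k ≤-refl) ⟩
    suc (f i)  ∎)
    where open ≤-Reasoning

balanced-unique : ∀ {k f g} → Balanced k f → Balanced k g → sum₁ k f ≡ sum₁ k g → AllIn1 k (λ h → f h ≡ g h)
balanced-unique bf bg Σf≡Σg h 1≤h h≤k =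
  ≤-antisym (balanced-≤ bf bg (≤-reflexive Σf≡Σg) h 1≤h h≤k) (balanced-≤ bg bf (≤-reflexive (sym Σf≡Σg)) h 1≤h h≤k)

[m+n]/n≡1+m/n : ∀ m n .{{_ : NonZero n}} → (m + n) / n ≡ suc (m / n)
[m+n]/n≡1+m/n m n = trans (m/n≡1+[m∸n]/n (m≤n+m n m)) (cong (λ x → suc (x / n)) (m+n∸n≡m m n))

-- ⌊(y + k − h)/k⌋ is the h-th largest part when y is split into k parts as equal as possible.
balancedPart : (k : ℕ) .{{_ : NonZero k}} → ℕ → ℕ → ℕ
balancedPart k y h = (y + k ∸ h) / k

module _ (k : ℕ) .{{_ : NonZero k}} where

  balancedPart-last : ∀ y → balancedPart k y k ≡ y / k
  balancedPart-last y = cong (_/ k) (m+n∸n≡m y k)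

  balancedPart-zero : ∀ {h} → 1 ≤ h → h ≤ k → balancedPart k 0 h ≡ 0
  balancedPart-zero 1≤h h≤k = m<n⇒m/n≡0 (∸-monoʳ-< 1≤h h≤k)

  balancedPart-mono-≤ : ∀ {y y′} h → y ≤ y′ → balancedPart k y h ≤ balancedPart k y′ h
  balancedPart-mono-≤ h y≤y′ = /-monoˡ-≤ k (∸-monoˡ-≤ h (+-monoˡ-≤ k y≤y′))

  balancedPart-balanced : ∀ y → Balanced k (balancedPart k y)
  balancedPart-balanced y = step , top
    where
    step : AllIn1 k (λ h → h < k → balancedPart k y (suc h) ≤ balancedPart k y h)
    step h _ _ _ = /-monoˡ-≤ k (∸-monoʳ-≤ (y + k) (n≤1+n h))
    top : balancedPart k y 1 ≤ suc (balancedPart k y k)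
    top = begin
      (y + k ∸ 1) / k    ≤⟨ /-monoˡ-≤ k (m∸n≤m (y + k) 1) ⟩
      (y + k) / k        ≡⟨ [m+n]/n≡1+m/n y k ⟩
      suc (y / k)        ≡⟨ cong suc (balancedPart-last y) ⟨
      suc (balancedPart k y k) ∎
      where open ≤-Reasoning

  balancedPart-+-* : ∀ y g {h} → h ≤ k → balancedPart k (y + k * g) h ≡ balancedPart k y h + g
  balancedPart-+-* y g {h} h≤k = begin
    (y + k * g + k ∸ h) / k       ≡⟨ cong (_/ k) (+-∸-assoc (y + k * g) h≤k) ⟩
    (y + k * g + (k ∸ h)) / k     ≡⟨ cong (_/ k) (regroup y (k * g) (k ∸ h)) ⟩
    (y + (k ∸ h) + k * g) / k     ≡⟨ +-distrib-/-∣ʳ (y + (k ∸ h)) (divides g (*-comm k g)) ⟩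
    (y + (k ∸ h)) / k + k * g / k ≡⟨ cong₂ _+_ (cong (_/ k) (sym (+-∸-assoc y h≤k))) (trans (cong (_/ k) (*-comm k g)) (m*n/n≡m g k)) ⟩
    (y + k ∸ h) / k + g           ∎
    where
    open ≡-Reasoning
    regroup : ∀ a b c → a + b + c ≡ a + c + b
    regroup = ℕ-Solver.solve-∀

  balancedPart-≤ : ∀ {z A h} → z ≤ k * A → 1 ≤ h → h ≤ k → balancedPart k z h ≤ A
  balancedPart-≤ {z} {A} {h} z≤kA 1≤h h≤k = begin
    balancedPart k z h            ≤⟨ balancedPart-mono-≤ h z≤kA ⟩
    balancedPart k (0 + k * A) h  ≡⟨ balancedPart-+-* 0 A h≤k ⟩
    balancedPart k 0 h + A        ≡⟨ cong (_+ A) (balancedPart-zero 1≤h h≤k) ⟩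
    A                             ∎
    where open ≤-Reasoning

  balancedPart-first≤last : ∀ {y y′} → y′ + k ≤ y → balancedPart k y′ 1 ≤ balancedPart k y k
  balancedPart-first≤last {y} {y′} y′+k≤y = begin
    balancedPart k y′ 1              ≤⟨ proj₂ (balancedPart-balanced y′) ⟩
    suc (balancedPart k y′ k)        ≡⟨ +-comm 1 _ ⟩
    balancedPart k y′ k + 1          ≡⟨ balancedPart-+-* y′ 1 ≤-refl ⟨
    balancedPart k (y′ + k * 1) k    ≤⟨ balancedPart-mono-≤ k (≤-trans (≤-reflexive (cong (_+_ y′) (*-identityʳ k))) y′+k≤y) ⟩
    balancedPart k y k               ∎
    where open ≤-Reasoning

sum₁-balancedPart : ∀ k .{{_ : NonZero k}} y → sum₁ k (balancedPart k y) ≡ y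
sum₁-balancedPart k@(suc k′) zero =
  trans (sum₁-cong k (λ h 1≤h h≤k → balancedPart-zero k 1≤h h≤k)) (trans (sum₁-const k 0) (*-zeroʳ k))
sum₁-balancedPart k@(suc k′) (suc y) = begin
  (y + k) / k + sum₁ k′ (balancedPart k y)        ≡⟨ cong (_+ sum₁ k′ (balancedPart k y)) ([m+n]/n≡1+m/n y k) ⟩
  suc (y / k + sum₁ k′ (balancedPart k y))        ≡⟨ cong suc (+-comm (y / k) _) ⟩
  suc (sum₁ k′ (balancedPart k y) + y / k)        ≡⟨ cong (λ x → suc (sum₁ k′ (balancedPart k y) + x)) (balancedPart-last k y) ⟨
  suc (sum₁ k′ (balancedPart k y) + balancedPart k y k) ≡⟨ cong suc (sum₁-snoc k′ (balancedPart k y)) ⟨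
  suc (sum₁ k (balancedPart k y))                 ≡⟨ cong suc (sum₁-balancedPart k y) ⟩
  suc y                                           ∎
  where open ≡-Reasoning

at-∷ : ∀ {n} x (xs : Vec ℕ n) {i} → 1 ≤ i → at (x ∷ xs) (suc i) ≡ at xs i
at-∷ x xs {suc i} _ = refl

at-++ˡ : ∀ {m n} (u : Vec ℕ m) (w : Vec ℕ n) {j} → 1 ≤ j → j ≤ m → at (u ++ᵥ w) j ≡ at u j
at-++ˡ (x ∷ u) w {suc zero}    _ _         = refl
at-++ˡ (x ∷ u) w {suc (suc j)} _ (s≤s j<m) = at-++ˡ u w (s≤s z≤n) j<m

at-++ʳ : ∀ {m n} (u : Vec ℕ m) (w : Vec ℕ n) {j} → 1 ≤ j → at (u ++ᵥ w) (m + j) ≡ at w j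
at-++ʳ []      w _   = refl
at-++ʳ (x ∷ u) w {j} 1≤j = trans (at-∷ x (u ++ᵥ w) (≤-trans 1≤j (m≤n+m j _))) (at-++ʳ u w 1≤j)

at-injective : ∀ {n} {u w : Vec ℕ n} → AllIn1 n (λ i → at u i ≡ at w i) → u ≡ w
at-injective {u = []}    {[]}    _   = refl
at-injective {u = x ∷ u} {y ∷ w} u≡w = cong₂ _∷_ (u≡w 1 ≤-refl (s≤s z≤n))
  (at-injective λ i 1≤i i≤n → trans (sym (at-∷ x u 1≤i)) (trans (u≡w (suc i) (s≤s z≤n) (s≤s i≤n)) (at-∷ y w 1≤i)))

tabulate₁ : ∀ n → (ℕ → ℕ) → Vec ℕ n
tabulate₁ zero    f = []
tabulate₁ (suc n) f = f 1 ∷ tabulate₁ n (f ∘ suc)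

at-tabulate₁ : ∀ n f {i} → 1 ≤ i → i ≤ n → at (tabulate₁ n f) i ≡ f i
at-tabulate₁ (suc n) f {suc zero}    _ _         = refl
at-tabulate₁ (suc n) f {suc (suc i)} _ (s≤s i<n) = at-tabulate₁ n (f ∘ suc) (s≤s z≤n) i<n

sum-tabulate₁ : ∀ n f → sumV (tabulate₁ n f) ≡ sum₁ n f
sum-tabulate₁ zero    f = refl
sum-tabulate₁ (suc n) f = cong (_+_ (f 1)) (sum-tabulate₁ n (f ∘ suc))

-- Blocks are numbered from 0 and their entries from 1, matching the 1-based `at`.
BlockPosition : (k r j : ℕ) → Set
BlockPosition k r j = Σ[ c ∈ ℕ ] Σ[ h ∈ ℕ ] c < r × 1 ≤ h × h ≤ k × j ≡ c * k + h

blockIndex : ∀ k r {j} → 1 ≤ j → j ≤ r * k → BlockPosition k r j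
blockIndex k zero    1≤j j≤0 = contradiction j≤0 (<⇒≱ 1≤j)
blockIndex k (suc r) {j} 1≤j j≤ with j ≤? k
... | yes j≤k = 0 , j , s≤s z≤n , 1≤j , j≤k , refl
... | no  j≰k with m≤n⇒∃[o]m+o≡n (<⇒≤ (≰⇒> j≰k))
... | j′ , refl with blockIndex k r (+-cancelˡ-≤ k 1 j′ (≤-trans (≤-reflexive (+-comm k 1)) (≰⇒> j≰k))) (+-cancelˡ-≤ k j′ (r * k) j≤)
... | c , h , c<r , 1≤h , h≤k , refl = suc c , h , s≤s c<r , 1≤h , h≤k , sym (+-assoc k (c * k) h)

module _ (k : ℕ) where

  offsetBy : ∀ {r} → Vec ℕ r → Vec ℕ r → Vec ℕ r
  offsetBy γ z = zipWith (λ x g → x + k * g) z γ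

  at-offsetBy : ∀ {r} (γ z : Vec ℕ r) {c} → c < r → at (offsetBy γ z) (suc c) ≡ at z (suc c) + k * at γ (suc c)
  at-offsetBy (g ∷ γ) (x ∷ z) {zero}  _         = refl
  at-offsetBy (g ∷ γ) (x ∷ z) {suc c} (s≤s c<r) = at-offsetBy γ z c<r

  sum-offsetBy : ∀ {r} (γ z : Vec ℕ r) → sumV (offsetBy γ z) ≡ sumV z + k * sumV γ
  sum-offsetBy []      []      = sym (*-zeroʳ k)
  sum-offsetBy (g ∷ γ) (x ∷ z) = trans (cong (_+_ (x + k * g)) (sum-offsetBy γ z)) (regroup x g (sumV z) (sumV γ) k)
    where
    regroup : ∀ x g s t k → x + k * g + (s + k * t) ≡ x + s + k * (g + t)
    regroup = ℕ-Solver.solve-∀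

  offsetBy-injective : ∀ {r} (γ z z′ : Vec ℕ r) → offsetBy γ z ≡ offsetBy γ z′ → z ≡ z′
  offsetBy-injective []      []      []        _  = refl
  offsetBy-injective (g ∷ γ) (x ∷ z) (x′ ∷ z′) eq = cong₂ _∷_
    (+-cancelʳ-≡ (k * g) x x′ (Vec.∷-injectiveˡ eq)) (offsetBy-injective γ z z′ (Vec.∷-injectiveʳ eq))

module _ (k : ℕ) .{{_ : NonZero k}} where

  blocks : ∀ {r} → Vec ℕ r → Vec ℕ (r * k)
  blocks []       = []
  blocks (y ∷ ys) = tabulate₁ k (balancedPart k y) ++ᵥ blocks ys

  at-blocks : ∀ {r} (ys : Vec ℕ r) {c h} → c < r → 1 ≤ h → h ≤ k →
              at (blocks ys) (c * k + h) ≡ balancedPart k (at ys (suc c)) h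
  at-blocks (y ∷ ys) {zero}      _         1≤h h≤k =
    trans (at-++ˡ (tabulate₁ k _) (blocks ys) 1≤h h≤k) (at-tabulate₁ k (balancedPart k y) 1≤h h≤k)
  at-blocks (y ∷ ys) {suc c} {h} (s≤s c<r) 1≤h h≤k =
    trans (cong (at (blocks (y ∷ ys))) (+-assoc k (c * k) h))
    (trans (at-++ʳ (tabulate₁ k _) (blocks ys) (≤-trans 1≤h (m≤n+m h (c * k))))
           (at-blocks ys c<r 1≤h h≤k))

  sum-tabulate₁-balancedPart : ∀ y → sumV (tabulate₁ k (balancedPart k y)) ≡ y
  sum-tabulate₁-balancedPart y = trans (sum-tabulate₁ k (balancedPart k y)) (sum₁-balancedPart k y)

  sum-blocks : ∀ {r} (ys : Vec ℕ r) → sumV (blocks ys) ≡ sumV ys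
  sum-blocks []       = refl
  sum-blocks (y ∷ ys) = trans (Vec.sum-++ (tabulate₁ k (balancedPart k y)))
                              (cong₂ _+_ (sum-tabulate₁-balancedPart y) (sum-blocks ys))

  blocks-injective : ∀ {r} (ys ys′ : Vec ℕ r) → blocks ys ≡ blocks ys′ → ys ≡ ys′
  blocks-injective []       []         _  = refl
  blocks-injective (y ∷ ys) (y′ ∷ ys′) eq with Vec.++-injective (tabulate₁ k (balancedPart k y)) (tabulate₁ k _) eq
  ... | head≡ , tail≡ = cong₂ _∷_
    (trans (sym (sum-tabulate₁-balancedPart y)) (trans (cong sumV head≡) (sum-tabulate₁-balancedPart y′)))
    (blocks-injective ys ys′ tail≡)

  blocks-antitone : ∀ {r} (ys : Vec ℕ r) → (∀ {c} → suc c < r → at ys (suc (suc c)) + k ≤ at ys (suc c)) →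
                    AllIn1 (r * k) (λ j → j < r * k → at (blocks ys) (suc j) ≤ at (blocks ys) j)
  blocks-antitone {r} ys gap j 1≤j j≤rk j<rk with blockIndex k r 1≤j j≤rk
  ... | c , h , c<r , 1≤h , h≤k , refl with h <? k
  ... | yes h<k = begin
    at (blocks ys) (suc (c * k + h))    ≡⟨ cong (at (blocks ys)) (+-suc (c * k) h) ⟨
    at (blocks ys) (c * k + suc h)      ≡⟨ at-blocks ys c<r (s≤s z≤n) h<k ⟩
    balancedPart k (at ys (suc c)) (suc h) ≤⟨ proj₁ (balancedPart-balanced k (at ys (suc c))) h 1≤h h≤k h<k ⟩
    balancedPart k (at ys (suc c)) h      ≡⟨ at-blocks ys c<r 1≤h h≤k ⟨
    at (blocks ys) (c * k + h)          ∎
    where open ≤-Reasoning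
  ... | no h≮k rewrite ≤-antisym h≤k (≮⇒≥ h≮k) = begin
    at (blocks ys) (suc (c * k + k))    ≡⟨ cong (at (blocks ys)) (next-block (c * k) k) ⟩
    at (blocks ys) (suc c * k + 1)      ≡⟨ at-blocks ys 1+c<r ≤-refl 1≤h ⟩
    balancedPart k (at ys (suc (suc c))) 1 ≤⟨ balancedPart-first≤last k (gap 1+c<r) ⟩
    balancedPart k (at ys (suc c)) k      ≡⟨ at-blocks ys c<r 1≤h ≤-refl ⟨
    at (blocks ys) (c * k + k)          ∎
    where
    open ≤-Reasoning
    next-block : ∀ m k → suc (m + k) ≡ k + m + 1
    next-block = ℕ-Solver.solve-∀
    1+c<r : suc c < r
    1+c<r with suc c <? r
    ... | yes 1+c<r = 1+c<r
    ... | no  1+c≮r = contradiction j<rk (≤⇒≯ (≤-trans (*-monoˡ-≤ k (≮⇒≥ 1+c≮r)) (≤-reflexive (+-comm k (c * k)))))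

  blocks-first≤last+1 : ∀ {r} (ys : Vec ℕ r) {c} → c < r → at (blocks ys) (c * k + 1) ≤ at (blocks ys) (suc c * k) + 1
  blocks-first≤last+1 ys {c} c<r = begin
    at (blocks ys) (c * k + 1)                 ≡⟨ at-blocks ys c<r ≤-refl k≥1 ⟩
    balancedPart k (at ys (suc c)) 1             ≤⟨ proj₂ (balancedPart-balanced k (at ys (suc c))) ⟩
    suc (balancedPart k (at ys (suc c)) k)       ≡⟨ cong suc (at-blocks ys c<r k≥1 ≤-refl) ⟨
    suc (at (blocks ys) (c * k + k))           ≡⟨ cong (suc ∘ at (blocks ys)) (+-comm (c * k) k) ⟩
    suc (at (blocks ys) (suc c * k))           ≡⟨ +-comm 1 _ ⟩
    at (blocks ys) (suc c * k) + 1             ∎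
    where
    open ≤-Reasoning
    k≥1 : 1 ≤ k
    k≥1 = >-nonZero⁻¹ k

All-at : ∀ {n} {P : ℕ → Set} {v : Vec ℕ n} → All P v → AllIn1 n (P ∘ at v)
All-at (px ∷ pv) (suc zero)    _ _         = px
All-at (px ∷ pv) (suc (suc i)) _ (s≤s i<n) = All-at pv (suc i) (s≤s z≤n) i<n

at⇒All : ∀ {n} {P : ℕ → Set} (v : Vec ℕ n) → AllIn1 n (P ∘ at v) → All P v
at⇒All []      _   = []
at⇒All {P = P} (x ∷ v) Pv = Pv 1 ≤-refl (s≤s z≤n) ∷ at⇒All v λ i 1≤i i≤n → subst P (at-∷ x v 1≤i) (Pv (suc i) (s≤s z≤n) (s≤s i≤n))

Descending-at-≤ : ∀ {r M} {z : Vec ℕ r} → Descending M z → ∀ {c} → c < r → at z (suc c) ≤ M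
Descending-at-≤ (x≤M ∷ d) {zero}  _         = x≤M
Descending-at-≤ (x≤M ∷ d) {suc c} (s≤s c<r) = ≤-trans (Descending-at-≤ d c<r) x≤M

Descending-at-step : ∀ {r M} {z : Vec ℕ r} → Descending M z → ∀ {c} → suc c < r → at z (suc (suc c)) ≤ at z (suc c)
Descending-at-step (_ ∷ (y≤x ∷ _)) {zero}  _          = y≤x
Descending-at-step (_ ∷ d)         {suc c} (s≤s c<r) = Descending-at-step d c<r

at⇒Descending : ∀ {r M} (z : Vec ℕ r) → (1 ≤ r → at z 1 ≤ M) →
                (∀ {c} → suc c < r → at z (suc (suc c)) ≤ at z (suc c)) → Descending M z
at⇒Descending []      _    _    = []
at⇒Descending (x ∷ z) head step = head (s≤s z≤n) ∷ at⇒Descending z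
  (λ { (s≤s _) → step (s≤s (s≤s z≤n)) }) (λ { (s≤s c<r) → step (s≤s (s≤s c<r)) })

-- Admissible sequences are shifted partitions

module Correspondence (a k r : ℕ) .{{_ : NonZero k}} (γ : Vec ℕ r) (1≤r : 1 ≤ r)
  (γ-decreasing : ∀ i j → 1 ≤ i → i < j → j ≤ r → at γ j < at γ i)
  (γ-last : at γ r ≡ 0) where

  M : ℕ
  M = k * (a ∸ at γ 1)

  fromPartition : Vec ℕ r → Vec ℕ (r * k)
  fromPartition z = blocks k (offsetBy k γ z)

  γ-step : ∀ {c} → suc c < r → suc (at γ (suc (suc c))) ≤ at γ (suc c)
  γ-step 1+c<r = γ-decreasing _ _ (s≤s z≤n) (n<1+n _) 1+c<r

  γ≤γ₁ : ∀ {c} → c < r → at γ (suc c) ≤ at γ 1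
  γ≤γ₁ {zero}  _   = ≤-refl
  γ≤γ₁ {suc c} c<r = <⇒≤ (γ-decreasing 1 (suc (suc c)) ≤-refl (s≤s (s≤s z≤n)) c<r)

  at-fromPartition : ∀ z {c h} → c < r → 1 ≤ h → h ≤ k →
                     at (fromPartition z) (c * k + h) ≡ balancedPart k (at z (suc c)) h + at γ (suc c)
  at-fromPartition z {c} {h} c<r 1≤h h≤k =
    trans (at-blocks k (offsetBy k γ z) c<r 1≤h h≤k)
    (trans (cong (λ y → balancedPart k y h) (at-offsetBy k γ z c<r)) (balancedPart-+-* k _ _ h≤k))

  sum-fromPartition : ∀ z → sumV (fromPartition z) ≡ k * sumV γ + sumV z
  sum-fromPartition z = trans (sum-blocks k (offsetBy k γ z)) (trans (sum-offsetBy k γ z) (+-comm (sumV z) _))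

  fromPartition-injective : ∀ z z′ → fromPartition z ≡ fromPartition z′ → z ≡ z′
  fromPartition-injective z z′ = offsetBy-injective k γ z z′ ∘ blocks-injective k _ _

  module _ {z : Vec ℕ r} (z-descending : Descending M z) (γ₁≤a : at γ 1 ≤ a) where

    fromPartition-bounded : All (_≤ a) (fromPartition z)
    fromPartition-bounded = at⇒All (fromPartition z) λ j 1≤j j≤rk → entry≤a (blockIndex k r 1≤j j≤rk)
      where
      entry≤a : ∀ {j} → BlockPosition k r j → at (fromPartition z) j ≤ a
      entry≤a (c , h , c<r , 1≤h , h≤k , refl) = begin
        at (fromPartition z) (c * k + h)               ≡⟨ at-fromPartition z c<r 1≤h h≤k ⟩
        balancedPart k (at z (suc c)) h + at γ (suc c) ≤⟨ +-mono-≤ (balancedPart-≤ k (Descending-at-≤ z-descending c<r) 1≤h h≤k) (γ≤γ₁ c<r) ⟩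
        a ∸ at γ 1 + at γ 1                            ≡⟨ m∸n+n≡m γ₁≤a ⟩
        a                                              ∎
        where open ≤-Reasoning

    offset-gap : ∀ {c} → suc c < r → at (offsetBy k γ z) (suc (suc c)) + k ≤ at (offsetBy k γ z) (suc c)
    offset-gap {c} 1+c<r = begin
      at (offsetBy k γ z) (suc (suc c)) + k         ≡⟨ cong (_+ k) (at-offsetBy k γ z 1+c<r) ⟩
      at z (suc (suc c)) + k * at γ (suc (suc c)) + k ≡⟨ +-assoc (at z (suc (suc c))) _ k ⟩
      at z (suc (suc c)) + (k * at γ (suc (suc c)) + k) ≡⟨ cong (_+_ (at z (suc (suc c)))) (trans (+-comm _ k) (sym (*-suc k _))) ⟩
      at z (suc (suc c)) + k * suc (at γ (suc (suc c))) ≤⟨ +-mono-≤ (Descending-at-step z-descending 1+c<r) (*-monoʳ-≤ k (γ-step 1+c<r)) ⟩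
      at z (suc c) + k * at γ (suc c)               ≡⟨ at-offsetBy k γ z (<⇒≤ 1+c<r) ⟨
      at (offsetBy k γ z) (suc c)                   ∎
      where open ≤-Reasoning

    fromPartition-admissible : Admissible a (r * k) k r γ (fromPartition z)
    fromPartition-admissible =
        All-at fromPartition-bounded 1 ≤-refl (≤-trans 1≤r (m≤m*n r k))
      , blocks-antitone k (offsetBy k γ z) offset-gap
      , (λ c c<r → blocks-first≤last+1 k (offsetBy k γ z) c<r)
      , λ c c<r-1 h 1≤h h≤k → shifted-block-step (≤-trans (s≤s c<r-1) (≤-reflexive (m+[n∸m]≡n 1≤r))) 1≤h h≤k
      where
      shifted-block-step : ∀ {c h} → suc c < r → 1 ≤ h → h ≤ k →
        at (fromPartition z) (suc c * k + h) + at γ (suc c) ≤ at (fromPartition z) (c * k + h) + at γ (suc (suc c))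
      shifted-block-step {c} {h} 1+c<r 1≤h h≤k = begin
        at (fromPartition z) (suc c * k + h) + at γ (suc c)
          ≡⟨ cong (_+ at γ (suc c)) (at-fromPartition z 1+c<r 1≤h h≤k) ⟩
        balancedPart k (at z (suc (suc c))) h + at γ (suc (suc c)) + at γ (suc c)
          ≡⟨ regroup _ (at γ (suc (suc c))) (at γ (suc c)) ⟩
        balancedPart k (at z (suc (suc c))) h + (at γ (suc c) + at γ (suc (suc c)))
          ≤⟨ +-monoˡ-≤ _ (balancedPart-mono-≤ k h (Descending-at-step z-descending 1+c<r)) ⟩
        balancedPart k (at z (suc c)) h + (at γ (suc c) + at γ (suc (suc c)))
          ≡⟨ +-assoc (balancedPart k (at z (suc c)) h) (at γ (suc c)) (at γ (suc (suc c))) ⟨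
        balancedPart k (at z (suc c)) h + at γ (suc c) + at γ (suc (suc c))
          ≡⟨ cong (_+ at γ (suc (suc c))) (at-fromPartition z (<⇒≤ 1+c<r) 1≤h h≤k) ⟨
        at (fromPartition z) (c * k + h) + at γ (suc (suc c)) ∎
        where
        open ≤-Reasoning
        regroup : ∀ x p q → x + p + q ≡ x + (q + p)
        regroup = ℕ-Solver.solve-∀

  module _ {Θ : Vec ℕ (r * k)} (admissible : Admissible a (r * k) k r γ Θ) (bounded : All (_≤ a) Θ) where

    private
      antitone = proj₁ (proj₂ admissible)
      condition₁ = proj₁ (proj₂ (proj₂ admissible))
      condition₂ = proj₂ (proj₂ (proj₂ admissible))

    entry : ℕ → ℕ → ℕ
    entry c h = at Θ (c * k + h)

    blockSum : ℕ → ℕ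
    blockSum c = sum₁ k (entry c)

    block-in-range : ∀ {c h} → c < r → h ≤ k → c * k + h ≤ r * k
    block-in-range {c} {h} c<r h≤k = ≤-trans (+-monoʳ-≤ (c * k) h≤k) (≤-trans (≤-reflexive (+-comm (c * k) k)) (*-monoˡ-≤ k c<r))

    entry-balanced : ∀ {c} → c < r → Balanced k (entry c)
    entry-balanced {c} c<r = step , top
      where
      step : AllIn1 k (λ h → h < k → entry c (suc h) ≤ entry c h)
      step h 1≤h _ h<k = subst (_≤ entry c h) (cong (at Θ) (sym (+-suc (c * k) h)))
        (antitone (c * k + h) (≤-trans 1≤h (m≤n+m h (c * k))) (<⇒≤ in-range) in-range)
        where
        in-range : c * k + h < r * k
        in-range = subst (_≤ r * k) (+-suc (c * k) h) (block-in-range c<r h<k)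
      top : entry c 1 ≤ suc (entry c k)
      top = ≤-trans (condition₁ c c<r) (≤-reflexive (trans (+-comm _ 1) (cong (suc ∘ at Θ) (+-comm k (c * k)))))

    entry≡balancedPart : ∀ {c} → c < r → AllIn1 k (λ h → entry c h ≡ balancedPart k (blockSum c) h)
    entry≡balancedPart {c} c<r = balanced-unique (entry-balanced c<r) (balancedPart-balanced k (blockSum c))
      (sym (sum₁-balancedPart k (blockSum c)))

    blockSum-step : ∀ {c} → suc c < r → blockSum (suc c) + k * at γ (suc c) ≤ blockSum c + k * at γ (suc (suc c))
    blockSum-step {c} 1+c<r = begin
      blockSum (suc c) + k * at γ (suc c)                ≡⟨ sum₁-+-const k (entry (suc c)) (at γ (suc c)) ⟨
      sum₁ k (λ h → entry (suc c) h + at γ (suc c))      ≤⟨ sum₁-mono-≤ k (condition₂ c c<r-1) ⟩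
      sum₁ k (λ h → entry c h + at γ (suc (suc c)))      ≡⟨ sum₁-+-const k (entry c) (at γ (suc (suc c))) ⟩
      blockSum c + k * at γ (suc (suc c))                ∎
      where
      open ≤-Reasoning
      c<r-1 : c < r ∸ 1
      c<r-1 = ∸-monoˡ-≤ 1 1+c<r

    -- Downward induction from the last block, where γ vanishes.
    kγ≤blockSum : ∀ {c} → c < r → k * at γ (suc c) ≤ blockSum c
    kγ≤blockSum {c} c<r = go (r ∸ suc c) (m+[n∸m]≡n c<r)
      where
      go : ∀ {c} d → suc c + d ≡ r → k * at γ (suc c) ≤ blockSum c
      go {c} zero    1+c≡r rewrite +-identityʳ (suc c) | 1+c≡r | γ-last | *-zeroʳ k = z≤n
      go {c} (suc d) 1+c+d≡r = +-cancelʳ-≤ (k * at γ (suc (suc c))) _ _ (begin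
        k * at γ (suc c) + k * at γ (suc (suc c)) ≤⟨ +-monoʳ-≤ _ (go d (trans (sym (+-suc (suc c) d)) 1+c+d≡r)) ⟩
        k * at γ (suc c) + blockSum (suc c)       ≡⟨ +-comm _ (blockSum (suc c)) ⟩
        blockSum (suc c) + k * at γ (suc c)       ≤⟨ blockSum-step 1+c<r ⟩
        blockSum c + k * at γ (suc (suc c))       ∎)
        where
        open ≤-Reasoning
        1+c<r : suc c < r
        1+c<r = ≤-trans (s≤s (s≤s (m≤m+n c d))) (≤-reflexive (trans (cong suc (sym (+-suc c d))) 1+c+d≡r))

    toPartition : Vec ℕ r
    toPartition = tabulate₁ r (λ i → blockSum (pred i) ∸ k * at γ i)

    at-toPartition : ∀ {c} → c < r → at toPartition (suc c) + k * at γ (suc c) ≡ blockSum c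
    at-toPartition c<r = trans (cong (_+ _) (at-tabulate₁ r _ (s≤s z≤n) c<r)) (m∸n+n≡m (kγ≤blockSum c<r))

    fromPartition-toPartition : fromPartition toPartition ≡ Θ
    fromPartition-toPartition = at-injective λ j 1≤j j≤rk → same-entry (blockIndex k r 1≤j j≤rk)
      where
      same-entry : ∀ {j} → BlockPosition k r j → at (fromPartition toPartition) j ≡ at Θ j
      same-entry (c , h , c<r , 1≤h , h≤k , refl) = begin
        at (fromPartition toPartition) (c * k + h)             ≡⟨ at-blocks k (offsetBy k γ toPartition) c<r 1≤h h≤k ⟩
        balancedPart k (at (offsetBy k γ toPartition) (suc c)) h ≡⟨ cong (λ y → balancedPart k y h) (trans (at-offsetBy k γ toPartition c<r) (at-toPartition c<r)) ⟩
        balancedPart k (blockSum c) h                          ≡⟨ entry≡balancedPart c<r h 1≤h h≤k ⟨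
        entry c h                                              ∎
        where open ≡-Reasoning

    blockSum₀≤ka : blockSum 0 ≤ k * a
    blockSum₀≤ka = ≤-trans (sum₁-mono-≤ k λ h 1≤h h≤k → All-at bounded h 1≤h (block-in-range 1≤r h≤k))
                           (≤-reflexive (sum₁-const k a))

    γ₁≤a : at γ 1 ≤ a
    γ₁≤a = *-cancelˡ-≤ k (≤-trans (kγ≤blockSum 1≤r) blockSum₀≤ka)

    toPartition-descending : Descending M toPartition
    toPartition-descending = at⇒Descending toPartition head step
      where
      head : 1 ≤ r → at toPartition 1 ≤ M
      head _ = begin
        at toPartition 1              ≡⟨ at-tabulate₁ r _ ≤-refl 1≤r ⟩
        blockSum 0 ∸ k * at γ 1       ≤⟨ ∸-monoˡ-≤ (k * at γ 1) blockSum₀≤ka ⟩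
        k * a ∸ k * at γ 1            ≡⟨ *-distribˡ-∸ k a (at γ 1) ⟨
        M                             ∎
        where open ≤-Reasoning
      step : ∀ {c} → suc c < r → at toPartition (suc (suc c)) ≤ at toPartition (suc c)
      step {c} 1+c<r = +-cancelʳ-≤ (k * at γ (suc (suc c)) + k * at γ (suc c)) _ _ (begin
        at toPartition (suc (suc c)) + (k * at γ (suc (suc c)) + k * at γ (suc c))
          ≡⟨ +-assoc (at toPartition (suc (suc c))) _ _ ⟨
        at toPartition (suc (suc c)) + k * at γ (suc (suc c)) + k * at γ (suc c)
          ≡⟨ cong (_+ k * at γ (suc c)) (at-toPartition 1+c<r) ⟩
        blockSum (suc c) + k * at γ (suc c)
          ≤⟨ blockSum-step 1+c<r ⟩
        blockSum c + k * at γ (suc (suc c))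
          ≡⟨ cong (_+ k * at γ (suc (suc c))) (at-toPartition (<⇒≤ 1+c<r)) ⟨
        at toPartition (suc c) + k * at γ (suc c) + k * at γ (suc (suc c))
          ≡⟨ regroup (at toPartition (suc c)) (k * at γ (suc c)) (k * at γ (suc (suc c))) ⟩
        at toPartition (suc c) + (k * at γ (suc (suc c)) + k * at γ (suc c)) ∎)
        where
        open ≤-Reasoning
        regroup : ∀ x p q → x + p + q ≡ x + (q + p)
        regroup = ℕ-Solver.solve-∀

  genFun-partitions : at γ 1 ≤ a → genFun a (r * k) k r γ ≋ qPow (k * sumV γ) *P gf (partitions r M)
  genFun-partitions γ₁≤a =
    ≋-trans (genFun-gf a (r * k) k r γ)
    (≋-trans (gf-↭ (↭-unique (Unique.filter⁺ adm? (allVecs-unique (r * k) a))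
                             (Unique.map⁺ (fromPartition-injective _ _) (partitions-unique r M))
                             admissible⇒image image⇒admissible))
             (gf-map fromPartition (k * sumV γ) sum-fromPartition (partitions r M)))
    where
    adm? = admissible? a (r * k) k r γ
    admissible⇒image : ∀ {Θ} → Θ ∈ filter adm? (allVecs (r * k) a) → Θ ∈ map fromPartition (partitions r M)
    admissible⇒image Θ∈ with ∈-filter⁻ adm? Θ∈
    ... | Θ∈all , adm = subst (_∈ map fromPartition (partitions r M)) (fromPartition-toPartition adm (∈-allVecs⁻ Θ∈all))
                              (∈-map⁺ fromPartition (∈-partitions⁺ (toPartition-descending adm (∈-allVecs⁻ Θ∈all))))
    image⇒admissible : ∀ {Θ} → Θ ∈ map fromPartition (partitions r M) → Θ ∈ filter adm? (allVecs (r * k) a)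
    image⇒admissible Θ∈ with ∈-map⁻ fromPartition Θ∈
    ... | z , z∈ , refl = ∈-filter⁺ adm? (∈-allVecs⁺ (fromPartition-bounded (∈-partitions⁻ z∈) γ₁≤a))
                                         (fromPartition-admissible (∈-partitions⁻ z∈) γ₁≤a)

  genFun-vanishes : a < at γ 1 → genFun a (r * k) k r γ ≋ zeroP
  genFun-vanishes a<γ₁ = ≋-trans (genFun-gf a (r * k) k r γ) (≡⇒≋ (cong gf (List.filter-none (admissible? a (r * k) k r γ)
    (ListAll.tabulate λ Θ∈ adm → <⇒≱ a<γ₁ (γ₁≤a adm (∈-allVecs⁻ Θ∈))))))

  genFun-isShiftedGaussian : at γ 1 ≤ a → IsShiftedGaussian (genFun a (r * k) k r γ) (k * sumV γ) (r + M) r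
  genFun-isShiftedGaussian γ₁≤a = isShiftedGaussian-partitions (k * sumV γ) r M (genFun-partitions γ₁≤a)

k*[r*r∸r]≡r*k*r∸r*k : ∀ k r → k * (r * r ∸ r) ≡ r * k * r ∸ r * k
k*[r*r∸r]≡r*k*r∸r*k k r = trans (*-distribˡ-∸ k (r * r) r) (cong₂ _∸_ (rearrange k r) (*-comm k r))
  where
  rearrange : ∀ k r → k * (r * r) ≡ r * k * r
  rearrange = ℕ-Solver.solve-∀

k*[a+2]+r∸2*[r*k]≡r+k*[a∸2*[r∸1]] : ∀ a k r → 1 ≤ r → 2 * (r ∸ 1) ≤ a →
  k * (a + 2) + r ∸ 2 * (r * k) ≡ r + k * (a ∸ 2 * (r ∸ 1))
k*[a+2]+r∸2*[r*k]≡r+k*[a∸2*[r∸1]] a k (suc r′) _ 2r′≤a with m≤n⇒∃[o]m+o≡n 2r′≤a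
... | d , refl = begin
  k * (2 * r′ + d + 2) + suc r′ ∸ 2 * (suc r′ * k)          ≡⟨ cong (_∸ 2 * (suc r′ * k)) (expand k r′ d) ⟩
  suc r′ + k * d + 2 * (suc r′ * k) ∸ 2 * (suc r′ * k)      ≡⟨ m+n∸n≡m (suc r′ + k * d) (2 * (suc r′ * k)) ⟩
  suc r′ + k * d                                            ≡⟨ cong (λ x → suc r′ + k * x) (m+n∸m≡n (2 * r′) d) ⟨
  suc r′ + k * (2 * r′ + d ∸ 2 * r′)                        ∎
  where
  open ≡-Reasoning
  expand : ∀ k r′ d → k * (2 * r′ + d + 2) + suc r′ ≡ suc r′ + k * d + 2 * (suc r′ * k)
  expand = ℕ-Solver.solve-∀

k*[a+2]+r∸2*[r*k]<r : ∀ a k r .{{_ : NonZero k}} → a < 2 * (r ∸ 1) → k * (a + 2) + r ∸ 2 * (r * k) < r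
k*[a+2]+r∸2*[r*k]<r a k (suc r′) a<2r′ = m<n+o⇒m∸n<o (k * (a + 2) + suc r′) (2 * (suc r′ * k)) (+-monoˡ-< (suc r′) (begin-strict
  k * (a + 2)           <⟨ *-monoʳ-< k (+-monoˡ-< 2 a<2r′) ⟩
  k * (2 * r′ + 2)      ≡⟨ expand k r′ ⟩
  2 * (suc r′ * k)      ∎))
  where
  open ≤-Reasoning
  expand : ∀ k r′ → k * (2 * r′ + 2) ≡ 2 * (suc r′ * k)
  expand = ℕ-Solver.solve-∀

isShiftedGaussian-genFun : ∀ a k r .{{_ : NonZero k}} (γ : Vec ℕ r) → 1 ≤ r →
  (∀ i j → 1 ≤ i → i < j → j ≤ r → at γ j < at γ i) → at γ r ≡ 0 →
  at γ 1 ≡ 2 * (r ∸ 1) → sum γ ≡ r * r ∸ r →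
  IsShiftedGaussian (genFun a (r * k) k r γ) (r * k * r ∸ r * k) (k * (a + 2) + r ∸ 2 * (r * k)) r
isShiftedGaussian-genFun a k r γ 1≤r decreasing last γ₁≡ Σγ≡ with 2 * (r ∸ 1) ≤? a
... | yes 2[r∸1]≤a = subst₂ (λ s N → IsShiftedGaussian (genFun a (r * k) k r γ) s N r)
  (trans (cong (k *_) Σγ≡) (k*[r*r∸r]≡r*k*r∸r*k k r))
  (trans (cong (λ g → r + k * (a ∸ g)) γ₁≡) (sym (k*[a+2]+r∸2*[r*k]≡r+k*[a∸2*[r∸1]] a k r 1≤r 2[r∸1]≤a)))
  (Correspondence.genFun-isShiftedGaussian a k r γ 1≤r decreasing last (subst (_≤ a) (sym γ₁≡) 2[r∸1]≤a))
... | no  2[r∸1]≰a = isShiftedGaussian-zero (r * k * r ∸ r * k) (k*[a+2]+r∸2*[r*k]<r a k r (≰⇒> 2[r∸1]≰a))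
  (Correspondence.genFun-vanishes a k r γ 1≤r decreasing last (subst (a <_) (sym γ₁≡) (≰⇒> 2[r∸1]≰a)))

corollary3p11 :
    (a b k : ℕ) → .{{_ : NonZero k}} → 0 < a → 0 < b → k ∣ b →
    (γ : Vec ℕ (b / k)) →
    (∀ i j → 1 ≤ i → i < j → j ≤ b / k → at γ j < at γ i) →
    at γ (b / k) ≡ 0 →
    at γ 1 ≡ 2 * (b / k ∸ 1) →
    sum γ ≡ (b / k) * (b / k) ∸ b / k →
    IsShiftedGaussian (genFun a b k (b / k) γ)
      (b * (b / k) ∸ b)
      (k * (a + 2) + b / k ∸ 2 * b)
      (b / k)
corollary3p11 a b k _ 0<b k∣b γ decreasing last γ₁≡ Σγ≡ =
  subst (λ b′ → IsShiftedGaussian (genFun a b′ k (b / k) γ) (b′ * (b / k) ∸ b′) (k * (a + 2) + b / k ∸ 2 * b′) (b / k))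
        (m/n*n≡m k∣b)
        (isShiftedGaussian-genFun a k (b / k) γ (m≥n⇒m/n>0 (∣⇒≤ {{>-nonZero 0<b}} k∣b)) decreasing last γ₁≡ Σγ≡)
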